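{- Let $w\in S_n$ contain the pattern $132$, let $p=\max\{t : \exists\, i<t<j,\ w_i<w_j<w_t\}$ and $q=\max\{j : j>p,\ w_j<w_p,\ \exists\, i<p,\ w_i<w_j\}$, and let $i\in I(wt_{p,q},p)$. Let $P$ be the bumpless pipedream of $w$ obtained from the Rothe pipedream $D(w)$ by applying the droop swapping the empty box $(p,w_q)$ and its pivot $(i,w_i)$. Then the Rothe diagram of $w'=wt_{p,q}t_{i,p}\in\Phi(wt_{p,q},p)$ equals the set of empty boxes of $P$.
   Context: Boxes of the $n\times n$ grid are $(r,c)$, row $r$ from top, column $c$ from left. A bumpless pipedream of $w\in S_n$: $n$ pipes, pipe $k$ entering from the south boundary in column $k$ and exiting the east boundary in row $w^{ -1}(k)$; pipes go only north or east; no two pipes share a step or cross twice; every box is empty, an NW elbow (enter west, exit north), an SE elbow (enter south, exit east), horizontal, vertical, or a crossing. The Rothe pipedream $D(w)$ has an SE elbow at each $(k,w_k)$ with pipes running right and down from there, and no NW elbows; its empty boxes form the Rothe diagram $\{(r,c): w_r>c,\ w^{ -1}(c)>r\}$. Droop: given an SE elbow at $e$ strictly northwest of an empty box $t$, with $R$ the rectangle with northwest corner $e$ and southeast corner $t$ and $L$ the pipe through $e$, if $L$ runs along the westmost column and northmost row of $R$, $R$ contains no elbow other than $e$, and the result is a bumpless pipedream, the droop reroutes $L$ to run instead along the southmost row and eastmost column of $R$ (so $e$ becomes empty, $t$ becomes an NW elbow, other pipes unchanged). A pivot of an empty box $(a,b)$ of $D(w)$ is an SE elbow $(k,w_k)$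 with $k<a$, $w_k<b$ such that the rectangle with corners $(k,w_k)$ and $(a,b)$ contains no other elbow. Further, $\ell(u)$ is the number of inversions, $ut_{a,b}$ swaps the entries in positions $a,b$, $I(u,k)=\{i<k:\ell(ut_{i,k})=\ell(u)+1\}$, and $\Phi(u,k)=\{ut_{i,k}:i\in I(u,k)\}$ when $I(u,k)\ne\emptyset$. (The box $(p,w_q)$ is empty in $D(w)$ and its pivots are exactly the $(i,w_i)$, $i\in I(wt_{p,q},p)$.) -}

module Defs where

open import Data.Nat using (ℕ; _+_)
open import Data.Bool using (Bool; true; false; _∧_; _∨_; not)
open import Data.Fin using (Fin; _<_; _<?_; _≤?_; _≟_)
open import Data.Fin.Permutation using (Permutation′; _⟨$⟩ʳ_; _⟨$⟩ˡ_; _∘ₚ_; transpose)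
open import Data.List using (List; length; filter; cartesianProduct; allFin)
open import Data.Product using (_×_; _,_; ∃-syntax; proj₁; proj₂)
open import Relation.Nullary.Decidable using (⌊_⌋; _×-dec_)
open import Relation.Binary.PropositionalEquality using (_≡_)

-- Permutations in S_n; rows, columns, positions and values are Fin n
-- (0-based; only the order of indices matters).

Perm : ℕ → Set
Perm n = Permutation′ n

_!_ : ∀ {n} → Perm n → Fin n → Fin n
w ! k = w ⟨$⟩ʳ k

_⁻¹!_ : ∀ {n} → Perm n → Fin n → Fin n
w ⁻¹! c = w ⟨$⟩ˡ c

-- u t_{a,b} : swap the entries in positions a and b,
-- i.e. (u t_{a,b})_x = u_{t_{a,b}(x)}
_·t[_,_] : ∀ {n} → Perm n → Fin n → Fin n → Perm n
u ·t[ a , b ] = transpose a b ∘ₚ u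

ℓ : ∀ {n} → Perm n → ℕ
ℓ {n} u = length (filter (λ ij → (proj₁ ij <? proj₂ ij) ×-dec (u ! proj₂ ij <? u ! proj₁ ij))
                         (cartesianProduct (allFin n) (allFin n)))

_∈I[_,_] : ∀ {n} → Fin n → Perm n → Fin n → Set
i ∈I[ u , k ] = i < k × ℓ (u ·t[ i , k ]) ≡ ℓ u + 1

Contains132 : ∀ {n} → Perm n → Set
Contains132 w = ∃[ i ] ∃[ t ] ∃[ j ] (i < t × t < j × w ! i < w ! j × w ! j < w ! t)

InRothe : ∀ {n} → Perm n → Fin n → Fin n → Set
InRothe w r c = c < w ! r × r < w ⁻¹! c

-- A tile is recorded by which of its four sides
-- (west, north, south, east) a pipe passes through:
--   empty = none, NW elbow = {W,N}, SE elbow = {S,E},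
--   horizontal = {W,E}, vertical = {S,N}, crossing = all four.

record Tile : Set where
  constructor tile
  field
    W N S E : Bool

IsEmpty : Tile → Set
IsEmpty t = t ≡ tile false false false false

-- a grid: box (r , c), row r from the top, column c from the left
Grid : ℕ → Set
Grid n = Fin n → Fin n → Tile

-- The Rothe pipedream D(w): SE elbow at (k, w_k), pipe running down
-- column w_k (to the south boundary) and right along row k (to the east
-- boundary).  Box (r,c) meets the vertical pipe of column c iff
-- r ≥ w^{-1}(c) (north side iff r > w^{-1}(c)), and the horizontal pipe
-- of row r iff c ≥ w_r (west side iff c > w_r).
rothePD : ∀ {n} → Perm n → Grid n
rothePD w r c = tile ⌊ w ! r <? c ⌋ ⌊ w ⁻¹! c <? r ⌋ ⌊ w ⁻¹! c ≤? r ⌋ ⌊ w ! r ≤? c ⌋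

-- The droop with SE elbow e = (a , b) and empty box t = (c , d), in the
-- rectangle R = [a,c] × [b,d].  The pipe L through e, which runs up the
-- westmost column of R and along its northmost row (turning at e), is
-- rerouted along the southmost row and eastmost column of R:
--   old route of L in R: (r,b) for a < r ≤ c : {S,N};  (a,b) : {S,E};
--                        (a,x) for b < x ≤ d : {W,E}
--   new route of L in R: (c,b) : {S,E};  (c,x) for b < x < d : {W,E};
--                        (c,d) : {W,N};  (r,d) for a < r < c : {S,N};
--                        (a,d) : {S,E}
-- Every other pipe is unchanged: the new tile is obtained by removing
-- the sides used by the old route of L and adding those of the new route.
module _ {n : ℕ} (a b c d : Fin n) where
  private
    _==_ : Fin n → Fin n → Bool
    x == y = ⌊ x ≟ y ⌋
    _<ᵇ_ : Fin n → Fin n → Bool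
    x <ᵇ y = ⌊ x <? y ⌋
    _≤ᵇ_ : Fin n → Fin n → Bool
    x ≤ᵇ y = ⌊ x ≤? y ⌋

  oldRoute : Fin n → Fin n → Tile
  oldRoute r x = tile
    ((r == a) ∧ (b <ᵇ x) ∧ (x ≤ᵇ d))
    ((x == b) ∧ (a <ᵇ r) ∧ (r ≤ᵇ c))
    ((x == b) ∧ (a ≤ᵇ r) ∧ (r ≤ᵇ c))
    ((r == a) ∧ (b ≤ᵇ x) ∧ (x ≤ᵇ d))

  newRoute : Fin n → Fin n → Tile
  newRoute r x = tile
    ((r == c) ∧ (b <ᵇ x) ∧ (x ≤ᵇ d))
    ((x == d) ∧ (a <ᵇ r) ∧ (r ≤ᵇ c))
    (((r == c) ∧ (x == b)) ∨ ((x == d) ∧ (a ≤ᵇ r) ∧ (r <ᵇ c)))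
    (((r == c) ∧ (b ≤ᵇ x) ∧ (x <ᵇ d)) ∨ ((r == a) ∧ (x == d)))

  reroute : Tile → Tile → Tile → Tile
  reroute (tile w₀ n₀ s₀ e₀) (tile w₁ n₁ s₁ e₁) (tile w₂ n₂ s₂ e₂) =
    tile ((w₀ ∧ not w₁) ∨ w₂) ((n₀ ∧ not n₁) ∨ n₂) ((s₀ ∧ not s₁) ∨ s₂) ((e₀ ∧ not e₁) ∨ e₂)

  droop : Grid n → Grid n
  droop P r x = reroute (P r x) (oldRoute r x) (newRoute r x)

PCand : ∀ {n} → Perm n → Fin n → Set
PCand w t = ∃[ i ] ∃[ j ] (i < t × t < j × w ! i < w ! j × w ! j < w ! t)

QCand : ∀ {n} → Perm n → Fin n → Fin n → Set
QCand w p j = p < j × w ! j < w ! p × ∃[ i ] (i < p × w ! i < w ! j)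

IsMax : ∀ {n} → (Fin n → Set) → Fin n → Set
IsMax P m = P m × (∀ x → P x → x Data.Fin.≤ m)

module Submission where

-- Write b = w_i, d = w_q, e = w_p, and L for the pipe through the SE elbow (i, b).  The droop
-- moves L from the west and north sides of the rectangle [i, p] × [b, d] to its south and
-- east sides, so a box is empty afterwards iff every pipe of D(w) through it was L and the
-- new route of L misses it.  The permutation W′ = w t_{p,q} t_{i,p} agrees with w except
-- that W′_i = d, W′_p = b and W′_q = e, and the two emptiness conditions are compared column
-- by column (columns b, d, e and all others).  Besides b < d < e this uses the two
-- maximality hypotheses: by maximality of p every k with p < k < q has w_k < d, and by
-- maximality of q no k > q has d < w_k < e.  The only consequence of i ∈ I(w t_{p,q}, p)
-- needed is b < d: otherwise t_{i,p} would undo an inversion, and counting inversions with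
-- the rows and columns i and p paired up shows that the length would drop.

open import Defs
open import Data.Bool using (true; false; _∧_; _∨_; not; T)
open import Data.Empty using (⊥-elim)
open import Data.Fin as Fin using (Fin; _≤_; _<_; _<?_; _≤?_; _≟_)
import Data.Fin.Properties as Fin
open import Data.Fin.Permutation using (inverseˡ; inverseʳ)
import Data.Fin.Permutation.Components as PC
open import Data.List using (length; filter; tabulate; cartesianProduct; map; _++_)
import Data.List.Properties as List
open import Data.Nat as ℕ using (ℕ; zero; suc; _+_; z≤n; s≤s)
import Data.Nat.Properties as ℕ
open import Data.Product using (_×_; _,_; proj₁; proj₂)
open import Data.Product.Function.NonDependent.Propositional using (_×-⇔_)
open import Data.Sum using (inj₁; inj₂)
open import Data.Unit using (tt)
open import Data.Vec.Functional using (head; tail)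
open import Function using (_∘_; case_of_)
open import Function.Bundles using (_⇔_; mk⇔; Equivalence)
open import Function.Construct.Composition using (_⇔-∘_)
open import Level using (0ℓ)
open import Relation.Binary.Definitions using (tri<; tri≈; tri>)
open import Relation.Binary.PropositionalEquality
open import Relation.Nullary using (Dec; yes; no; ¬_; _×-dec_)
open import Relation.Nullary.Decidable using (⌊_⌋; dec-true; dec-false)
open import Relation.Nullary.Reflects using (Reflects; ofʸ; ofⁿ; _×-reflects_; _⊎-reflects_)
open import Relation.Unary using (Pred; Decidable)

open import Algebra.Properties.CommutativeMonoid.Sum ℕ.+-0-commutativeMonoid
  using (sum; sum-syntax; ∑-distrib-+)
open import Algebra.Properties.CommutativeSemigroup ℕ.+-commutativeSemigroup
  using (xy∙z≈xz∙y; xy∙z≈y∙xz)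

𝟙 : ∀ {A : Set} → Dec A → ℕ
𝟙 (yes _) = 1
𝟙 (no _) = 0

module _ {A : Set} where

  𝟙-yes : (a? : Dec A) → A → 𝟙 a? ≡ 1
  𝟙-yes (yes _) _ = refl
  𝟙-yes (no ¬a) a = ⊥-elim (¬a a)

  𝟙-no : (a? : Dec A) → ¬ A → 𝟙 a? ≡ 0
  𝟙-no (yes a) ¬a = ⊥-elim (¬a a)
  𝟙-no (no _) _ = refl

  𝟙-mono : ∀ {B : Set} (a? : Dec A) (b? : Dec B) → (A → B) → 𝟙 a? ℕ.≤ 𝟙 b?
  𝟙-mono (no _) _ _ = z≤n
  𝟙-mono (yes _) (yes _) _ = ℕ.≤-refl
  𝟙-mono (yes a) (no ¬b) f = ⊥-elim (¬b (f a))

module _ {A : Set} {P : Pred A 0ℓ} (P? : Decidable P) where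

  length-filter-tabulate : ∀ {m} (f : Fin m → A) →
    length (filter P? (tabulate f)) ≡ ∑[ k < m ] 𝟙 (P? (f k))
  length-filter-tabulate {zero} f = refl
  length-filter-tabulate {suc m} f with P? (head f)
  ... | yes _ = cong suc (length-filter-tabulate (tail f))
  ... | no _ = length-filter-tabulate (tail f)

module _ {A B : Set} {P : Pred (A × B) 0ℓ} (P? : Decidable P) where

  length-filter-cartesianProduct : ∀ {m k} (f : Fin m → A) (g : Fin k → B) →
    length (filter P? (cartesianProduct (tabulate f) (tabulate g)))
      ≡ ∑[ x < m ] ∑[ y < k ] 𝟙 (P? (f x , g y))
  length-filter-cartesianProduct {zero} f g = refl
  length-filter-cartesianProduct {suc m} f g = begin
    length (filter P? (first-row ++ rest))
      ≡⟨ cong length (List.filter-++ P? first-row rest) ⟩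
    length (filter P? first-row ++ filter P? rest)
      ≡⟨ List.length-++ (filter P? first-row) ⟩
    length (filter P? first-row) + length (filter P? rest)
      ≡⟨ cong₂ _+_ (cong (length ∘ filter P?) (List.map-tabulate g (head f ,_)))
                   (length-filter-cartesianProduct (tail f) g) ⟩
    length (filter P? (tabulate ((head f ,_) ∘ g))) + _
      ≡⟨ cong (_+ _) (length-filter-tabulate P? ((head f ,_) ∘ g)) ⟩
    _ ∎
    where
    open ≡-Reasoning
    first-row = map (head f ,_) (tabulate g)
    rest = cartesianProduct (tabulate (tail f)) (tabulate g)

∑-mono-≤ : ∀ {n} {f g : Fin n → ℕ} → (∀ x → f x ℕ.≤ g x) → sum f ℕ.≤ sum g
∑-mono-≤ {zero} _ = z≤n
∑-mono-≤ {suc n} f≤g = ℕ.+-mono-≤ (f≤g Fin.zero) (∑-mono-≤ (f≤g ∘ Fin.suc))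

∑-mono-≤-except : ∀ {n} {f g : Fin n → ℕ} (k : Fin n) {a c : ℕ} →
  f k + a ℕ.≤ g k + c → (∀ x → x ≢ k → f x ℕ.≤ g x) → sum f + a ℕ.≤ sum g + c
∑-mono-≤-except {suc n} {f} {g} Fin.zero {a} {c} fk≤gk f≤g = begin
  head f + sum (tail f) + a  ≡⟨ xy∙z≈xz∙y (head f) (sum (tail f)) a ⟩
  head f + a + sum (tail f)  ≤⟨ ℕ.+-mono-≤ fk≤gk (∑-mono-≤ λ x → f≤g (Fin.suc x) λ ()) ⟩
  head g + c + sum (tail g)  ≡⟨ xy∙z≈xz∙y (head g) c (sum (tail g)) ⟩
  head g + sum (tail g) + c  ∎
  where open ℕ.≤-Reasoning
∑-mono-≤-except {suc n} {f} {g} (Fin.suc k) {a} {c} fk≤gk f≤g = begin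
  head f + sum (tail f) + a    ≡⟨ ℕ.+-assoc (head f) (sum (tail f)) a ⟩
  head f + (sum (tail f) + a)  ≤⟨ ℕ.+-mono-≤ (f≤g Fin.zero λ ())
                                    (∑-mono-≤-except k fk≤gk λ x x≢k →
                                       f≤g (Fin.suc x) (x≢k ∘ Fin.suc-injective)) ⟩
  head g + (sum (tail g) + c)  ≡⟨ ℕ.+-assoc (head g) (sum (tail g)) c ⟨
  head g + sum (tail g) + c    ∎
  where open ℕ.≤-Reasoning

∑-mono-≤-except-pair : ∀ {n} {f g : Fin n → ℕ} (i p : Fin n) {a : ℕ} → i ≢ p →
  f i + f p + a ℕ.≤ g i + g p → (∀ x → x ≢ i → x ≢ p → f x ℕ.≤ g x) → sum f + a ℕ.≤ sum g
∑-mono-≤-except-pair {suc n} Fin.zero Fin.zero i≢p _ _ = ⊥-elim (i≢p refl)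
∑-mono-≤-except-pair {suc n} {f} {g} Fin.zero (Fin.suc p) {a} _ fip≤gip f≤g = begin
  head f + sum (tail f) + a    ≡⟨ xy∙z≈y∙xz (head f) (sum (tail f)) a ⟩
  sum (tail f) + (head f + a)  ≤⟨ ∑-mono-≤-except p
                                    (subst₂ ℕ._≤_ (xy∙z≈y∙xz (head f) (tail f p) a) (ℕ.+-comm (head g) _)
                                            fip≤gip)
                                    (λ x x≢p → f≤g (Fin.suc x) (λ ()) (x≢p ∘ Fin.suc-injective)) ⟩
  sum (tail g) + head g        ≡⟨ ℕ.+-comm _ (head g) ⟩
  head g + sum (tail g)        ∎
  where open ℕ.≤-Reasoning
∑-mono-≤-except-pair {suc n} {f} {g} (Fin.suc i) Fin.zero {a} _ fip≤gip f≤g = begin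
  head f + sum (tail f) + a    ≡⟨ xy∙z≈y∙xz (head f) (sum (tail f)) a ⟩
  sum (tail f) + (head f + a)  ≤⟨ ∑-mono-≤-except i
                                    (subst (ℕ._≤ tail g i + head g) (ℕ.+-assoc (tail f i) (head f) a) fip≤gip)
                                    (λ x x≢i → f≤g (Fin.suc x) (x≢i ∘ Fin.suc-injective) (λ ())) ⟩
  sum (tail g) + head g        ≡⟨ ℕ.+-comm _ (head g) ⟩
  head g + sum (tail g)        ∎
  where open ℕ.≤-Reasoning
∑-mono-≤-except-pair {suc n} {f} {g} (Fin.suc i) (Fin.suc p) {a} i≢p fip≤gip f≤g = begin
  head f + sum (tail f) + a    ≡⟨ ℕ.+-assoc (head f) (sum (tail f)) a ⟩
  head f + (sum (tail f) + a)  ≤⟨ ℕ.+-mono-≤ (f≤g Fin.zero (λ ()) (λ ()))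
                                    (∑-mono-≤-except-pair i p (i≢p ∘ cong Fin.suc) fip≤gip λ x x≢i x≢p →
                                       f≤g (Fin.suc x) (x≢i ∘ Fin.suc-injective) (x≢p ∘ Fin.suc-injective)) ⟩
  head g + sum (tail g)        ∎
  where open ℕ.≤-Reasoning

∑-mono-≤-pair : ∀ {n} {f g : Fin n → ℕ} (i p : Fin n) → i ≢ p →
  f i + f p ℕ.≤ g i + g p → (∀ x → x ≢ i → x ≢ p → f x ℕ.≤ g x) → sum f ℕ.≤ sum g
∑-mono-≤-pair {f = f} {g} i p i≢p fip≤gip f≤g =
  subst (ℕ._≤ sum g) (ℕ.+-identityʳ (sum f))
    (∑-mono-≤-except-pair i p i≢p
      (subst (ℕ._≤ g i + g p) (sym (ℕ.+-identityʳ (f i + f p))) fip≤gip) f≤g)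

!-injective : ∀ {n} (u : Perm n) {a b : Fin n} → u ! a ≡ u ! b → a ≡ b
!-injective u {a} {b} ua≡ub = begin
  a              ≡⟨ inverseˡ u ⟨
  u ⁻¹! (u ! a)  ≡⟨ cong (u ⁻¹!_) ua≡ub ⟩
  u ⁻¹! (u ! b)  ≡⟨ inverseˡ u ⟩
  b              ∎
  where open ≡-Reasoning

!⇒⁻¹! : ∀ {n} (u : Perm n) {k x : Fin n} → u ! k ≡ x → u ⁻¹! x ≡ k
!⇒⁻¹! u refl = inverseˡ u

record Swapped {n} (f g : Fin n → Fin n) (i p : Fin n) : Set where
  field
    at-i : g i ≡ f p
    at-p : g p ≡ f i
    elsewhere : ∀ x → x ≢ i → x ≢ p → g x ≡ f x

Swapped-sym : ∀ {n} {f g : Fin n → Fin n} {i p : Fin n} → Swapped f g i p → Swapped g f i p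
Swapped-sym swapped = record
  { at-i = sym at-p
  ; at-p = sym at-i
  ; elsewhere = λ x x≢i x≢p → sym (elsewhere x x≢i x≢p)
  }
  where open Swapped swapped

·t-swapped : ∀ {n} (u : Perm n) (i p : Fin n) → Swapped (u !_) ((u ·t[ i , p ]) !_) i p
·t-swapped u i p = record
  { at-i = cong (u !_) transpose-matchˡ
  ; at-p = cong (u !_) transpose-matchʳ
  ; elsewhere = λ x x≢i x≢p → cong (u !_) (transpose-other x≢i x≢p)
  }
  where
  transpose-matchˡ : PC.transpose i p i ≡ p
  transpose-matchˡ rewrite dec-true (i ≟ i) refl = refl

  transpose-matchʳ : PC.transpose i p p ≡ i
  transpose-matchʳ with p ≟ i
  ... | yes p≡i = p≡i
  ... | no _ rewrite dec-true (p ≟ p) refl = refl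

  transpose-other : ∀ {x} → x ≢ i → x ≢ p → PC.transpose i p x ≡ x
  transpose-other {x} x≢i x≢p rewrite dec-false (x ≟ i) x≢i | dec-false (x ≟ p) x≢p = refl

-- Opaque, so that goals keep the shape `inversion f x y` that the lemmas below are stated in.
opaque
  inversion : ∀ {n} → (Fin n → Fin n) → Fin n → Fin n → ℕ
  inversion f x y = 𝟙 ((x <? y) ×-dec (f y <? f x))

inversions : ∀ {n} → (Fin n → Fin n) → ℕ
inversions {n} f = ∑[ x < n ] ∑[ y < n ] inversion f x y

opaque
  unfolding inversion

  ℓ≡inversions : ∀ {n} (u : Perm n) → ℓ u ≡ inversions (u !_)
  ℓ≡inversions {n} u = length-filter-cartesianProduct _ {n} {n} (λ x → x) (λ y → y)

  inversion-mono : ∀ {n} {f g : Fin n → Fin n} {x y x′ y′ : Fin n} →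
    (x < y × f y < f x → x′ < y′ × g y′ < g x′) → inversion f x y ℕ.≤ inversion g x′ y′
  inversion-mono {f = f} {g} {x} {y} {x′} {y′} =
    𝟙-mono ((x <? y) ×-dec (f y <? f x)) ((x′ <? y′) ×-dec (g y′ <? g x′))

  inversion-yes : ∀ {n} {f : Fin n → Fin n} {x y : Fin n} → x < y → f y < f x → inversion f x y ≡ 1
  inversion-yes {f = f} {x} {y} x<y fy<fx = 𝟙-yes ((x <? y) ×-dec (f y <? f x)) (x<y , fy<fx)

  inversion-no : ∀ {n} {f : Fin n → Fin n} {x y : Fin n} → ¬ (x < y × f y < f x) → inversion f x y ≡ 0
  inversion-no {f = f} {x} {y} = 𝟙-no ((x <? y) ×-dec (f y <? f x))

module _ {n : ℕ} {f g : Fin n → Fin n} {i p : Fin n} (i<p : i < p)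
         (swapped : Swapped f g i p) (fi<fp : f i < f p) where
  open Swapped swapped
  open ℕ.≤-Reasoning

  private
    i≢p : i ≢ p
    i≢p = Fin.<⇒≢ i<p

    columns-ip : ∀ x → x ≢ i → x ≢ p →
      inversion f x i + inversion f x p ℕ.≤ inversion g x i + inversion g x p
    columns-ip x x≢i x≢p with gx ← elsewhere x x≢i x≢p = case x <? i of λ where
      (yes x<i) → begin
        inversion f x i + inversion f x p
          ≤⟨ ℕ.+-mono-≤
               (inversion-mono λ (_ , fi<fx) → Fin.<-trans x<i i<p , subst₂ _<_ (sym at-p) (sym gx) fi<fx)
               (inversion-mono λ (_ , fp<fx) → x<i , subst₂ _<_ (sym at-i) (sym gx) fp<fx) ⟩
        inversion g x p + inversion g x i  ≡⟨ ℕ.+-comm (inversion g x p) _ ⟩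
        inversion g x i + inversion g x p  ∎
      (no x≮i) → ℕ.+-mono-≤
        (inversion-mono λ (x<i , _) → ⊥-elim (x≮i x<i))
        (inversion-mono λ (x<p , fp<fx) → x<p , subst₂ _<_ (sym at-p) (sym gx) (Fin.<-trans fi<fp fp<fx))

    rows-ip : ∀ y → y ≢ i → y ≢ p →
      inversion f i y + inversion f p y ℕ.≤ inversion g i y + inversion g p y
    rows-ip y y≢i y≢p with gy ← elsewhere y y≢i y≢p = case p <? y of λ where
      (yes p<y) → begin
        inversion f i y + inversion f p y
          ≤⟨ ℕ.+-mono-≤
               (inversion-mono λ (_ , fy<fi) → p<y , subst₂ _<_ (sym gy) (sym at-p) fy<fi)
               (inversion-mono λ (_ , fy<fp) → Fin.<-trans i<p p<y , subst₂ _<_ (sym gy) (sym at-i) fy<fp) ⟩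
        inversion g p y + inversion g i y  ≡⟨ ℕ.+-comm (inversion g p y) _ ⟩
        inversion g i y + inversion g p y  ∎
      (no p≮y) → ℕ.+-mono-≤
        (inversion-mono λ (i<y , fy<fi) → i<y , subst₂ _<_ (sym gy) (sym at-i) (Fin.<-trans fy<fi fi<fp))
        (inversion-mono λ (p<y , _) → ⊥-elim (p≮y p<y))

    block-ip : inversion f i i + inversion f p i + (inversion f i p + inversion f p p) + 1
             ℕ.≤ inversion g i i + inversion g p i + (inversion g i p + inversion g p p)
    block-ip = begin
      inversion f i i + inversion f p i + (inversion f i p + inversion f p p) + 1
        ≡⟨ cong (_+ 1) (cong₂ _+_
             (cong₂ _+_ (inversion-no λ (i<i , _) → Fin.<-irrefl refl i<i)
                        (inversion-no λ (p<i , _) → Fin.<-asym i<p p<i))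
             (cong₂ _+_ (inversion-no λ (_ , fp<fi) → Fin.<-asym fi<fp fp<fi)
                        (inversion-no λ (p<p , _) → Fin.<-irrefl refl p<p))) ⟩
      1                                  ≡⟨ inversion-yes i<p (subst₂ _<_ (sym at-p) (sym at-i) fi<fp) ⟨
      inversion g i p                    ≤⟨ ℕ.m≤m+n _ _ ⟩
      inversion g i p + inversion g p p  ≤⟨ ℕ.m≤n+m _ (inversion g i i + inversion g p i) ⟩
      inversion g i i + inversion g p i + (inversion g i p + inversion g p p) ∎

    others : ∀ x y → x ≢ i → x ≢ p → y ≢ i → y ≢ p → inversion f x y ℕ.≤ inversion g x y
    others x y x≢i x≢p y≢i y≢p = inversion-mono λ (x<y , fy<fx) →
      x<y , subst₂ _<_ (sym (elsewhere y y≢i y≢p)) (sym (elsewhere x x≢i x≢p)) fy<fx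

    row : (Fin n → Fin n) → Fin n → ℕ
    row h x = ∑[ y < n ] inversion h x y

    rows-i-and-p : row f i + row f p + 1 ℕ.≤ row g i + row g p
    rows-i-and-p = begin
      row f i + row f p + 1
        ≡⟨ cong (_+ 1) (∑-distrib-+ (inversion f i) (inversion f p)) ⟨
      ∑[ y < n ] (inversion f i y + inversion f p y) + 1
        ≤⟨ ∑-mono-≤-except-pair i p i≢p block-ip rows-ip ⟩
      ∑[ y < n ] (inversion g i y + inversion g p y)
        ≡⟨ ∑-distrib-+ (inversion g i) (inversion g p) ⟩
      row g i + row g p
        ∎

  inversions-swapped-< : inversions f ℕ.< inversions g
  inversions-swapped-< = subst (ℕ._≤ inversions g) (ℕ.+-comm (inversions f) 1)
    (∑-mono-≤-except-pair i p i≢p rows-i-and-p λ x x≢i x≢p →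
      ∑-mono-≤-pair i p i≢p (columns-ip x x≢i x≢p) λ y y≢i y≢p →
        others x y x≢i x≢p y≢i y≢p)

ℓ-·t-< : ∀ {n} (u : Perm n) {i p : Fin n} → i < p → u ! p < u ! i → ℓ (u ·t[ i , p ]) ℕ.< ℓ u
ℓ-·t-< u {i} {p} i<p up<ui =
  subst₂ ℕ._<_ (sym (ℓ≡inversions (u ·t[ i , p ]))) (sym (ℓ≡inversions u))
    (inversions-swapped-< i<p (Swapped-sym swapped) (subst₂ _<_ (sym at-i) (sym at-p) up<ui))
  where
  swapped = ·t-swapped u i p
  open Swapped swapped

∈I⇒< : ∀ {n} (u : Perm n) {i p : Fin n} → i ∈I[ u , p ] → u ! i < u ! p
∈I⇒< u {i} {p} (i<p , ℓ-+1) with Fin.<-cmp (u ! i) (u ! p)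
... | tri< ui<up _ _ = ui<up
... | tri≈ _ ui≡up _ = ⊥-elim (Fin.<⇒≢ i<p (!-injective u ui≡up))
... | tri> _ _ up<ui = ⊥-elim (ℕ.<-asym (ℓ-·t-< u i<p up<ui)
                                        (subst (ℓ u ℕ.<_) (sym ℓ-+1) (ℕ.m<m+n (ℓ u) (s≤s z≤n))))

_⊆ᵗ_ : Tile → Tile → Set
tile w n s e ⊆ᵗ tile w′ n′ s′ e′ = (T w → T w′) × (T n → T n′) × (T s → T s′) × (T e → T e′)

tile-empty : ∀ {w n s e} → IsEmpty (tile w n s e) ⇔ (¬ T w × ¬ T n × ¬ T s × ¬ T e)
tile-empty = mk⇔ to from
  where
  to : ∀ {w n s e} → IsEmpty (tile w n s e) → ¬ T w × ¬ T n × ¬ T s × ¬ T e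
  to refl = (λ ()) , (λ ()) , (λ ()) , (λ ())
  ≡false : ∀ {b} → ¬ T b → b ≡ false
  ≡false {false} _ = refl
  ≡false {true} ¬T = ⊥-elim (¬T tt)
  from : ∀ {w n s e} → ¬ T w × ¬ T n × ¬ T s × ¬ T e → IsEmpty (tile w n s e)
  from (w , n , s , e) rewrite ≡false w | ≡false n | ≡false s | ≡false e = refl

rerouted-side-empty : ∀ x y z → (¬ T ((x ∧ not y) ∨ z)) ⇔ ((T x → T y) × ¬ T z)
rerouted-side-empty x y z = mk⇔ (to x y z) (from x y z)
  where
  to : ∀ x y z → ¬ T ((x ∧ not y) ∨ z) → (T x → T y) × ¬ T z
  to false y     false _  = (λ ()) , (λ ())
  to true  true  false _  = (λ _ → tt) , (λ ())
  to true  false false ¬T = ⊥-elim (¬T tt)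
  to false y     true  ¬T = ⊥-elim (¬T tt)
  to true  true  true  ¬T = ⊥-elim (¬T tt)
  to true  false true  ¬T = ⊥-elim (¬T tt)
  from : ∀ x y z → (T x → T y) × ¬ T z → ¬ T ((x ∧ not y) ∨ z)
  from true  false false (x→y , _) _ = x→y tt
  from false y     true  (_ , ¬z) _ = ¬z tt
  from true  true  true  (_ , ¬z) _ = ¬z tt
  from true  false true  (_ , ¬z) _ = ¬z tt

reroute-empty : ∀ {n} (a b c d : Fin n) (t o m : Tile) →
  IsEmpty (reroute a b c d t o m) ⇔ (t ⊆ᵗ o × IsEmpty m)
reroute-empty a b c d (tile w₀ n₀ s₀ e₀) (tile w₁ n₁ s₁ e₁) (tile w₂ n₂ s₂ e₂) = mk⇔
  (λ empty →
    let ((w⊆ , ¬w) , (n⊆ , ¬n) , (s⊆ , ¬s) , (e⊆ , ¬e)) = to sides (to tile-empty empty)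
    in (w⊆ , n⊆ , s⊆ , e⊆) , from tile-empty (¬w , ¬n , ¬s , ¬e))
  (λ ((w⊆ , n⊆ , s⊆ , e⊆) , empty) →
    let (¬w , ¬n , ¬s , ¬e) = to tile-empty empty
    in from tile-empty (from sides ((w⊆ , ¬w) , (n⊆ , ¬n) , (s⊆ , ¬s) , (e⊆ , ¬e))))
  where
  open Equivalence
  sides = rerouted-side-empty w₀ w₁ w₂ ×-⇔ rerouted-side-empty n₀ n₁ n₂
       ×-⇔ rerouted-side-empty s₀ s₁ s₂ ×-⇔ rerouted-side-empty e₀ e₁ e₂

⌊⌋-reflects : ∀ {A : Set} (a? : Dec A) → Reflects A ⌊ a? ⌋
⌊⌋-reflects (yes a) = ofʸ a
⌊⌋-reflects (no ¬a) = ofⁿ ¬a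

T-reflects⇔ : ∀ {A : Set} {b} → Reflects A b → T b ⇔ A
T-reflects⇔ (ofʸ a) = mk⇔ (λ _ → a) (λ _ → tt)
T-reflects⇔ (ofⁿ ¬a) = mk⇔ (λ ()) ¬a

module _ {n : ℕ} (w : Perm n) (a c d r x : Fin n) where
  private
    b = w ! a
    R = ⌊⌋-reflects
    open Equivalence

  rothePD-⊆-oldRoute :
    rothePD w r x ⊆ᵗ oldRoute a b c d r x
      ⇔ ((w ! r ≤ x → r ≡ a × x ≤ d) × (w ⁻¹! x ≤ r → x ≡ b × r ≤ c))
  rothePD-⊆-oldRoute = mk⇔
    (λ (_ , _ , S⊆ , E⊆) →
      (λ wr≤x → let r≡a , _ , x≤d = to E-route (E⊆ (from (T-reflects⇔ (R (w ! r ≤? x))) wr≤x))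
                in r≡a , x≤d) ,
      (λ w⁻x≤r → let x≡b , _ , r≤c = to S-route (S⊆ (from (T-reflects⇔ (R (w ⁻¹! x ≤? r))) w⁻x≤r))
                 in x≡b , r≤c))
    (λ (row , column) →
      (λ T-W → let wr<x = to (T-reflects⇔ (R (w ! r <? x))) T-W
                   r≡a , x≤d = row (ℕ.<⇒≤ wr<x)
               in from W-route (r≡a , subst (_< x) (cong (w !_) r≡a) wr<x , x≤d)) ,
      (λ T-N → let w⁻x<r = to (T-reflects⇔ (R (w ⁻¹! x <? r))) T-N
                   x≡b , r≤c = column (ℕ.<⇒≤ w⁻x<r)
               in from N-route (x≡b , subst (_< r) (!⇒⁻¹! w (sym x≡b)) w⁻x<r , r≤c)) ,
      (λ T-S → let w⁻x≤r = to (T-reflects⇔ (R (w ⁻¹! x ≤? r))) T-S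
                   x≡b , r≤c = column w⁻x≤r
               in from S-route (x≡b , subst (_≤ r) (!⇒⁻¹! w (sym x≡b)) w⁻x≤r , r≤c)) ,
      (λ T-E → let wr≤x = to (T-reflects⇔ (R (w ! r ≤? x))) T-E
                   r≡a , x≤d = row wr≤x
               in from E-route (r≡a , subst (_≤ x) (cong (w !_) r≡a) wr≤x , x≤d)))
    where
    W-route = T-reflects⇔ (R (r ≟ a) ×-reflects R (b <? x) ×-reflects R (x ≤? d))
    N-route = T-reflects⇔ (R (x ≟ b) ×-reflects R (a <? r) ×-reflects R (r ≤? c))
    S-route = T-reflects⇔ (R (x ≟ b) ×-reflects R (a ≤? r) ×-reflects R (r ≤? c))
    E-route = T-reflects⇔ (R (r ≟ a) ×-reflects R (b ≤? x) ×-reflects R (x ≤? d))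

module _ {n : ℕ} (a b c d r x : Fin n) where
  private
    R = ⌊⌋-reflects
    open Equivalence

  newRoute-empty : a ≤ c → b ≤ d →
    IsEmpty (newRoute a b c d r x) ⇔ (¬ (r ≡ c × b ≤ x × x ≤ d) × ¬ (x ≡ d × a ≤ r × r ≤ c))
  newRoute-empty a≤c b≤d = mk⇔
    (λ empty → let ¬W , ¬N , ¬S , ¬E = to tile-empty empty in
      (λ (r≡c , b≤x , x≤d) → case x ≟ b of λ where
          (yes x≡b) → ¬S (from S-route (inj₁ (r≡c , x≡b)))
          (no x≢b) → ¬W (from W-route (r≡c , Fin.≤∧≢⇒< b≤x (x≢b ∘ sym) , x≤d))) ,
      (λ (x≡d , a≤r , r≤c) → case r ≟ a of λ where
          (yes r≡a) → ¬E (from E-route (inj₂ (r≡a , x≡d)))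
          (no r≢a) → ¬N (from N-route (x≡d , Fin.≤∧≢⇒< a≤r (r≢a ∘ sym) , r≤c))))
    (λ (¬row , ¬column) → from tile-empty
      ( (λ T-W → let r≡c , b<x , x≤d = to W-route T-W in ¬row (r≡c , ℕ.<⇒≤ b<x , x≤d))
      , (λ T-N → let x≡d , a<r , r≤c = to N-route T-N in ¬column (x≡d , ℕ.<⇒≤ a<r , r≤c))
      , (λ T-S → case to S-route T-S of λ where
          (inj₁ (r≡c , refl)) → ¬row (r≡c , Fin.≤-refl , b≤d)
          (inj₂ (x≡d , a≤r , r<c)) → ¬column (x≡d , a≤r , ℕ.<⇒≤ r<c))
      , (λ T-E → case to E-route T-E of λ where
          (inj₁ (r≡c , b≤x , x<d)) → ¬row (r≡c , b≤x , ℕ.<⇒≤ x<d)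
          (inj₂ (refl , x≡d)) → ¬column (x≡d , Fin.≤-refl , a≤c))))
    where
    W-route = T-reflects⇔ (R (r ≟ c) ×-reflects R (b <? x) ×-reflects R (x ≤? d))
    N-route = T-reflects⇔ (R (x ≟ d) ×-reflects R (a <? r) ×-reflects R (r ≤? c))
    S-route = T-reflects⇔ ((R (r ≟ c) ×-reflects R (x ≟ b))
                           ⊎-reflects (R (x ≟ d) ×-reflects R (a ≤? r) ×-reflects R (r <? c)))
    E-route = T-reflects⇔ ((R (r ≟ c) ×-reflects R (b ≤? x) ×-reflects R (x <? d))
                           ⊎-reflects (R (r ≟ a) ×-reflects R (x ≟ d)))

-- L is the pipe through the SE elbow (a, w_a); in D(w) the pipe of row r meets (r, x) iff
-- w_r ≤ x, and the pipe of column x meets it iff w⁻¹(x) ≤ r.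
record EmptyAfterDroop {n} (w : Perm n) (a c d r x : Fin n) : Set where
  field
    row-of-L : w ! r ≤ x → r ≡ a × x ≤ d
    column-of-L : w ⁻¹! x ≤ r → x ≡ w ! a × r ≤ c
    off-new-row : ¬ (r ≡ c × w ! a ≤ x × x ≤ d)
    off-new-column : ¬ (x ≡ d × a ≤ r × r ≤ c)

droop-rothePD-empty : ∀ {n} (w : Perm n) {a c d : Fin n} → a ≤ c → w ! a ≤ d → ∀ r x →
  IsEmpty (droop a (w ! a) c d (rothePD w) r x) ⇔ EmptyAfterDroop w a c d r x
droop-rothePD-empty w {a} {c} {d} a≤c b≤d r x =
  as-record ⇔-∘ ((rothePD-⊆-oldRoute w a c d r x ×-⇔ newRoute-empty a b c d r x a≤c b≤d)
             ⇔-∘ reroute-empty a b c d (rothePD w r x) (oldRoute a b c d r x) (newRoute a b c d r x))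
  where
  b = w ! a
  as-record = mk⇔
    (λ ((row , column) , new-row , new-column) → record
      { row-of-L = row ; column-of-L = column ; off-new-row = new-row ; off-new-column = new-column })
    (λ e → let open EmptyAfterDroop e in (row-of-L , column-of-L) , off-new-row , off-new-column)

module PivotDroop {n : ℕ} (w : Perm n) {i p q : Fin n}
  (i<p : i < p) (p<q : p < q) (wi<wq : w ! i < w ! q) (wq<wp : w ! q < w ! p)
  (below-q : ∀ k → p < k → k < q → w ! k < w ! q)
  (not-between : ∀ k → q < k → w ! q < w ! k → ¬ w ! k < w ! p) where

  W′ : Perm n
  W′ = (w ·t[ p , q ]) ·t[ i , p ]

  private
    i<q : i < q
    i<q = Fin.<-trans i<p p<q
    wi<wp : w ! i < w ! p
    wi<wp = Fin.<-trans wi<wq wq<wp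
    i≢p : i ≢ p
    i≢p = Fin.<⇒≢ i<p
    i≢q : i ≢ q
    i≢q = Fin.<⇒≢ i<q
    p≢q : p ≢ q
    p≢q = Fin.<⇒≢ p<q
    module Outer = Swapped (·t-swapped (w ·t[ p , q ]) i p)
    module Inner = Swapped (·t-swapped w p q)

  data Position : Fin n → Set where
    is-i : Position i
    is-p : Position p
    is-q : Position q
    other : ∀ {k} → k ≢ i → k ≢ p → k ≢ q → Position k

  position : ∀ k → Position k
  position k with k ≟ i | k ≟ p | k ≟ q
  ... | yes refl | _        | _        = is-i
  ... | no _     | yes refl | _        = is-p
  ... | no _     | no _     | yes refl = is-q
  ... | no k≢i   | no k≢p   | no k≢q   = other k≢i k≢p k≢q

  W′-i : W′ ! i ≡ w ! q
  W′-i = trans Outer.at-i Inner.at-i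

  W′-p : W′ ! p ≡ w ! i
  W′-p = trans Outer.at-p (Inner.elsewhere i i≢p i≢q)

  W′-q : W′ ! q ≡ w ! p
  W′-q = trans (Outer.elsewhere q (i≢q ∘ sym) (p≢q ∘ sym)) Inner.at-p

  W′-other : ∀ {k} → k ≢ i → k ≢ p → k ≢ q → W′ ! k ≡ w ! k
  W′-other {k} k≢i k≢p k≢q = trans (Outer.elsewhere k k≢i k≢p) (Inner.elsewhere k k≢p k≢q)

  W′⁻¹-i : W′ ⁻¹! (w ! i) ≡ p
  W′⁻¹-i = !⇒⁻¹! W′ W′-p

  W′⁻¹-p : W′ ⁻¹! (w ! p) ≡ q
  W′⁻¹-p = !⇒⁻¹! W′ W′-q

  W′⁻¹-q : W′ ⁻¹! (w ! q) ≡ i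
  W′⁻¹-q = !⇒⁻¹! W′ W′-i

  W′⁻¹-other : ∀ {k} → k ≢ i → k ≢ p → k ≢ q → W′ ⁻¹! (w ! k) ≡ k
  W′⁻¹-other k≢i k≢p k≢q = !⇒⁻¹! W′ (W′-other k≢i k≢p k≢q)

  Empty : Fin n → Fin n → Set
  Empty = EmptyAfterDroop w i p (w ! q)

  open EmptyAfterDroop

  private
    preimage-≤ : ∀ {k r : Fin n} → k ≤ r → w ⁻¹! (w ! k) ≤ r
    preimage-≤ {r = r} = subst (_≤ r) (sym (inverseˡ w))

  empty⇒rothe-column-i : ∀ {r} → Position r → Empty r (w ! i) → InRothe W′ r (w ! i)
  empty⇒rothe-column-i is-i e = subst (w ! i <_) (sym W′-i) wi<wq , subst (i <_) (sym W′⁻¹-i) i<p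
  empty⇒rothe-column-i is-p e = ⊥-elim (off-new-row e (refl , Fin.≤-refl , ℕ.<⇒≤ wi<wq))
  empty⇒rothe-column-i is-q e = ⊥-elim (ℕ.<⇒≱ p<q (proj₂ (column-of-L e (preimage-≤ (ℕ.<⇒≤ i<q)))))
  empty⇒rothe-column-i {r} (other r≢i r≢p r≢q) e =
    subst (w ! i <_) (sym (W′-other r≢i r≢p r≢q)) (ℕ.≰⇒> (r≢i ∘ proj₁ ∘ row-of-L e)) ,
    subst (r <_) (sym W′⁻¹-i) (ℕ.≰⇒> λ p≤r →
      r≢p (Fin.≤-antisym (proj₂ (column-of-L e (preimage-≤ (Fin.≤-trans (ℕ.<⇒≤ i<p) p≤r)))) p≤r))

  private
    row-of-L-column-i : ∀ {r} → Position r → InRothe W′ r (w ! i) →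
      w ! r ≤ w ! i → r ≡ i × w ! i ≤ w ! q
    row-of-L-column-i is-i _ _ = refl , ℕ.<⇒≤ wi<wq
    row-of-L-column-i is-p (_ , p<p) _ = ⊥-elim (Fin.<-irrefl refl (subst (p <_) W′⁻¹-i p<p))
    row-of-L-column-i is-q (_ , q<p) _ = ⊥-elim (Fin.<-asym p<q (subst (q <_) W′⁻¹-i q<p))
    row-of-L-column-i (other r≢i r≢p r≢q) (wi<W′r , _) wr≤wi =
      ⊥-elim (ℕ.<⇒≱ (subst (w ! i <_) (W′-other r≢i r≢p r≢q) wi<W′r) wr≤wi)

  rothe⇒empty-column-i : ∀ {r} → Position r → InRothe W′ r (w ! i) → Empty r (w ! i)
  rothe⇒empty-column-i {r} pos rothe@(_ , r<W′⁻¹) = record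
    { row-of-L = row-of-L-column-i pos rothe
    ; column-of-L = λ _ → refl , ℕ.<⇒≤ r<p
    ; off-new-row = λ (r≡p , _) → Fin.<⇒≢ r<p r≡p
    ; off-new-column = λ (wi≡wq , _) → Fin.<⇒≢ wi<wq wi≡wq
    }
    where
    r<p : r < p
    r<p = subst (r <_) W′⁻¹-i r<W′⁻¹

  private
    right-of-p-not-between : ∀ k → p < k → k ≢ q → w ! q < w ! k → ¬ w ! k < w ! p
    right-of-p-not-between k p<k k≢q wq<wk = case k <? q of λ where
      (yes k<q) → λ _ → Fin.<-asym wq<wk (below-q k p<k k<q)
      (no k≮q) → not-between k (Fin.≤∧≢⇒< (ℕ.≮⇒≥ k≮q) (k≢q ∘ sym)) wq<wk

    empty-column-p⇒ : ∀ {r} → Empty r (w ! p) → r < p × w ! p < w ! r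
    empty-column-p⇒ e =
      ℕ.≰⇒> (λ p≤r → Fin.<⇒≢ wi<wp (sym (proj₁ (column-of-L e (preimage-≤ p≤r))))) ,
      ℕ.≰⇒> (λ wr≤wp → ℕ.<⇒≱ wq<wp (proj₂ (row-of-L e wr≤wp)))

    rothe-column-p⇒ : ∀ {r} → Position r → InRothe W′ r (w ! p) → r < p × w ! p < w ! r
    rothe-column-p⇒ is-i (wp<W′i , _) = ⊥-elim (Fin.<-asym wq<wp (subst (w ! p <_) W′-i wp<W′i))
    rothe-column-p⇒ is-p (wp<W′p , _) = ⊥-elim (Fin.<-asym wi<wp (subst (w ! p <_) W′-p wp<W′p))
    rothe-column-p⇒ is-q (_ , q<W′⁻¹) = ⊥-elim (Fin.<-irrefl refl (subst (q <_) W′⁻¹-p q<W′⁻¹))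
    rothe-column-p⇒ {r} (other r≢i r≢p r≢q) (wp<W′r , r<W′⁻¹) =
      ℕ.≰⇒> (λ p≤r → Fin.<-asym wq<wp
        (Fin.<-trans wp<wr
          (below-q r (Fin.≤∧≢⇒< p≤r (r≢p ∘ sym)) (subst (r <_) W′⁻¹-p r<W′⁻¹)))) ,
      wp<wr
      where
      wp<wr = subst (w ! p <_) (W′-other r≢i r≢p r≢q) wp<W′r

  empty⇒rothe-column-p : ∀ {r} → Position r → Empty r (w ! p) → InRothe W′ r (w ! p)
  empty⇒rothe-column-p is-i e = ⊥-elim (Fin.<-asym wi<wp (proj₂ (empty-column-p⇒ e)))
  empty⇒rothe-column-p is-p e = ⊥-elim (Fin.<-irrefl refl (proj₁ (empty-column-p⇒ e)))
  empty⇒rothe-column-p is-q e = ⊥-elim (Fin.<-asym p<q (proj₁ (empty-column-p⇒ e)))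
  empty⇒rothe-column-p {r} (other r≢i r≢p r≢q) e =
    let r<p , wp<wr = empty-column-p⇒ e in
    subst (w ! p <_) (sym (W′-other r≢i r≢p r≢q)) wp<wr , subst (r <_) (sym W′⁻¹-p) (Fin.<-trans r<p p<q)

  rothe⇒empty-column-p : ∀ {r} → Position r → InRothe W′ r (w ! p) → Empty r (w ! p)
  rothe⇒empty-column-p {r} pos rothe = let r<p , wp<wr = rothe-column-p⇒ pos rothe in record
    { row-of-L = λ wr≤wp → ⊥-elim (ℕ.<⇒≱ wp<wr wr≤wp)
    ; column-of-L = λ w⁻wp≤r → ⊥-elim (ℕ.<⇒≱ r<p (subst (_≤ r) (inverseˡ w) w⁻wp≤r))
    ; off-new-row = λ (r≡p , _) → Fin.<⇒≢ r<p r≡p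
    ; off-new-column = λ (wp≡wq , _) → Fin.<⇒≢ wq<wp (sym wp≡wq)
    }

  empty⇒rothe-column-q : ∀ {r} → Position r → Empty r (w ! q) → InRothe W′ r (w ! q)
  empty⇒rothe-column-q is-i e = ⊥-elim (off-new-column e (refl , Fin.≤-refl , ℕ.<⇒≤ i<p))
  empty⇒rothe-column-q is-p e = ⊥-elim (off-new-column e (refl , ℕ.<⇒≤ i<p , Fin.≤-refl))
  empty⇒rothe-column-q is-q e = ⊥-elim (Fin.<⇒≢ wi<wq (sym (proj₁ (column-of-L e (preimage-≤ Fin.≤-refl)))))
  empty⇒rothe-column-q {r} (other r≢i r≢p r≢q) e =
    subst (w ! q <_) (sym (W′-other r≢i r≢p r≢q)) (ℕ.≰⇒> (r≢i ∘ proj₁ ∘ row-of-L e)) ,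
    subst (r <_) (sym W′⁻¹-q) (ℕ.≰⇒> λ i≤r → case r ≤? p of λ where
      (yes r≤p) → off-new-column e (refl , i≤r , r≤p)
      (no r≰p) → r≢i (proj₁ (row-of-L e (ℕ.<⇒≤ (below-q r (ℕ.≰⇒> r≰p) r<q)))))
    where
    r<q : r < q
    r<q = ℕ.≰⇒> λ q≤r → Fin.<⇒≢ wi<wq (sym (proj₁ (column-of-L e (preimage-≤ q≤r))))

  rothe⇒empty-column-q : ∀ {r} → InRothe W′ r (w ! q) → Empty r (w ! q)
  rothe⇒empty-column-q {r} (wq<W′r , r<W′⁻¹) = record
    { row-of-L = λ wr≤wq → ⊥-elim (ℕ.<⇒≱ wq<wr wr≤wq)
    ; column-of-L = λ w⁻wq≤r →
        ⊥-elim (ℕ.<⇒≱ (Fin.<-trans r<i i<q) (subst (_≤ r) (inverseˡ w) w⁻wq≤r))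
    ; off-new-row = λ (r≡p , _) → Fin.<⇒≢ (Fin.<-trans r<i i<p) r≡p
    ; off-new-column = λ (_ , i≤r , _) → ℕ.<⇒≱ r<i i≤r
    }
    where
    r<i : r < i
    r<i = subst (r <_) W′⁻¹-q r<W′⁻¹
    wq<wr : w ! q < w ! r
    wq<wr = subst (w ! q <_)
      (W′-other (Fin.<⇒≢ r<i) (Fin.<⇒≢ (Fin.<-trans r<i i<p)) (Fin.<⇒≢ (Fin.<-trans r<i i<q))) wq<W′r

  module _ {s : Fin n} (s≢i : s ≢ i) (s≢p : s ≢ p) (s≢q : s ≢ q) where

    empty⇒rothe-other-column : ∀ {r} → Position r → Empty r (w ! s) → InRothe W′ r (w ! s)
    empty⇒rothe-other-column {r} pos e = ws<W′r pos , subst (r <_) (sym (W′⁻¹-other s≢i s≢p s≢q)) r<s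
      where
      r<s : r < s
      r<s = ℕ.≰⇒> λ s≤r → s≢i (!-injective w (proj₁ (column-of-L e (preimage-≤ s≤r))))
      ws<W′r : Position r → w ! s < W′ ! r
      ws<W′r is-i = subst (w ! s <_) (sym W′-i) (case w ! s <? w ! q of λ where
        (yes ws<wq) → ws<wq
        (no ws≮wq) → let wq≤ws = ℕ.≮⇒≥ ws≮wq
                         ws≤wq = proj₂ (row-of-L e (Fin.≤-trans (ℕ.<⇒≤ wi<wq) wq≤ws))
                     in ⊥-elim (s≢q (!-injective w (Fin.≤-antisym ws≤wq wq≤ws))))
      ws<W′r is-p = subst (w ! s <_) (sym W′-p) (case w ! s <? w ! i of λ where
        (yes ws<wi) → ws<wi
        (no ws≮wi) → ⊥-elim (case w ! s ≤? w ! q of λ where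
          (yes ws≤wq) → off-new-row e (refl , ℕ.≮⇒≥ ws≮wi , ws≤wq)
          (no ws≰wq) → right-of-p-not-between s r<s s≢q (ℕ.≰⇒> ws≰wq)
                         (ℕ.≰⇒> λ wp≤ws → i≢p (sym (proj₁ (row-of-L e wp≤ws))))))
      ws<W′r is-q = subst (w ! s <_) (sym W′-q)
        (Fin.<-trans (ℕ.≰⇒> λ wq≤ws → i≢q (sym (proj₁ (row-of-L e wq≤ws)))) wq<wp)
      ws<W′r (other r≢i r≢p r≢q) =
        subst (w ! s <_) (sym (W′-other r≢i r≢p r≢q)) (ℕ.≰⇒> (r≢i ∘ proj₁ ∘ row-of-L e))

    private
      row-conditions : ∀ {r} → Position r → w ! s < W′ ! r → r < s →
        (w ! r ≤ w ! s → r ≡ i × w ! s ≤ w ! q) × ¬ (r ≡ p × w ! i ≤ w ! s × w ! s ≤ w ! q)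
      row-conditions is-i ws<W′i _ =
        (λ _ → refl , ℕ.<⇒≤ (subst (w ! s <_) W′-i ws<W′i)) , λ (i≡p , _) → i≢p i≡p
      row-conditions is-p ws<W′p _ =
        (λ wp≤ws → ⊥-elim (ℕ.<⇒≱ (Fin.<-trans ws<wi wi<wp) wp≤ws)) ,
        λ (_ , wi≤ws , _) → ℕ.<⇒≱ ws<wi wi≤ws
        where ws<wi = subst (w ! s <_) W′-p ws<W′p
      row-conditions is-q ws<W′q q<s =
        (λ wq≤ws → ⊥-elim (not-between s q<s (Fin.≤∧≢⇒< wq≤ws (s≢q ∘ !-injective w ∘ sym))
                                              (subst (w ! s <_) W′-q ws<W′q))) ,
        λ (q≡p , _) → p≢q (sym q≡p)
      row-conditions (other r≢i r≢p r≢q) ws<W′r _ =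
        (λ wr≤ws → ⊥-elim (ℕ.<⇒≱ (subst (w ! s <_) (W′-other r≢i r≢p r≢q) ws<W′r) wr≤ws)) ,
        λ (r≡p , _) → r≢p r≡p

    rothe⇒empty-other-column : ∀ {r} → Position r → InRothe W′ r (w ! s) → Empty r (w ! s)
    rothe⇒empty-other-column {r} pos (ws<W′r , r<W′⁻¹) = record
      { row-of-L = proj₁ (row-conditions pos ws<W′r r<s)
      ; column-of-L = λ w⁻ws≤r → ⊥-elim (ℕ.<⇒≱ r<s (subst (_≤ r) (inverseˡ w) w⁻ws≤r))
      ; off-new-row = proj₂ (row-conditions pos ws<W′r r<s)
      ; off-new-column = λ (ws≡wq , _) → s≢q (!-injective w ws≡wq)
      }
      where
      r<s : r < s
      r<s = subst (r <_) (W′⁻¹-other s≢i s≢p s≢q) r<W′⁻¹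

  empty⇔rothe : ∀ r x → Empty r x ⇔ InRothe W′ r x
  empty⇔rothe r x =
    subst (λ x → Empty r x ⇔ InRothe W′ r x) (inverseʳ w) (by-column (position (w ⁻¹! x)))
    where
    by-column : ∀ {s} → Position s → Empty r (w ! s) ⇔ InRothe W′ r (w ! s)
    by-column is-i = mk⇔ (empty⇒rothe-column-i (position r)) (rothe⇒empty-column-i (position r))
    by-column is-p = mk⇔ (empty⇒rothe-column-p (position r)) (rothe⇒empty-column-p (position r))
    by-column is-q = mk⇔ (empty⇒rothe-column-q (position r)) rothe⇒empty-column-q
    by-column (other s≢i s≢p s≢q) =
      mk⇔ (empty⇒rothe-other-column s≢i s≢p s≢q (position r))
          (rothe⇒empty-other-column s≢i s≢p s≢q (position r))

proposition4p6 : ∀ {n} (w : Perm n) → Contains132 w →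
    (p q i : Fin n) →
    IsMax (PCand w) p →
    IsMax (QCand w p) q →
    i ∈I[ w ·t[ p , q ] , p ] →
    ∀ r c →
      IsEmpty (droop i (w ! i) p (w ! q) (rothePD w) r c)
        ⇔ InRothe ((w ·t[ p , q ]) ·t[ i , p ]) r c
-- The 132 hypothesis only guarantees that p exists; here p is given.
proposition4p6 w _ p q i (_ , p-max) ((p<q , wq<wp , _) , q-max) i∈I@(i<p , _) r c =
  empty⇔rothe r c ⇔-∘ droop-rothePD-empty w (ℕ.<⇒≤ i<p) (ℕ.<⇒≤ wi<wq) r c
  where
  module Swap = Swapped (·t-swapped w p q)

  wi<wq : w ! i < w ! q
  wi<wq = subst₂ _<_ (Swap.elsewhere i (Fin.<⇒≢ i<p) (Fin.<⇒≢ (Fin.<-trans i<p p<q))) Swap.at-i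
                     (∈I⇒< (w ·t[ p , q ]) i∈I)

  below-q : ∀ k → p < k → k < q → w ! k < w ! q
  below-q k p<k k<q = case w ! k <? w ! q of λ where
    (yes wk<wq) → wk<wq
    (no wk≮wq) → ⊥-elim (ℕ.<⇒≱ p<k (p-max k (i , q , Fin.<-trans i<p p<k , k<q , wi<wq ,
                   Fin.≤∧≢⇒< (ℕ.≮⇒≥ wk≮wq) (Fin.<⇒≢ k<q ∘ !-injective w ∘ sym))))

  not-between : ∀ k → q < k → w ! q < w ! k → ¬ w ! k < w ! p
  not-between k q<k wq<wk wk<wp =
    ℕ.<⇒≱ q<k (q-max k (Fin.<-trans p<q q<k , wk<wp , i , i<p , Fin.<-trans wi<wq wq<wk))

  open PivotDroop w i<p p<q wi<wq wq<wp below-q not-between
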